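{- Let $u\in\mathbb{A}^n$ and $S\subseteq\mathcal{S}(n)$. The following are equivalent: (i) $S$ palindromically generates $u$; (ii) for all $1\le i<j\le n$, we have $u[i]=u[j]$ if and only if there exists a finite sequence $(I_t)_{t=1}^r$ of elements of $S$ such that $j=\rho_{I_r}\rho_{I_{r-1}}\cdots\rho_{I_1}(i)$ (each reflection being applied to a position in its domain).
   Context: $\mathbb{A}$ is a finite nonempty alphabet. For $u=u_1\cdots u_n$, $u[i,j]=u_i\cdots u_j$ and $u[i]=u_i$; $\mathcal{S}(n)=\{(i,j)\mid 1\le i\le j\le n\}$; $\mathrm{alph}(u)$ is the set of letters of $u$. A set $S\subseteq\mathcal{S}(n)$ palindromically generates $u\in\mathbb{A}^n$ if (1) $u[i,j]$ is a palindrome for all $(i,j)\in S$, and (2) for every nonempty set $\mathbb{B}$ and every $v\in\mathbb{B}^n$ with $v[i,j]$ a palindrome for all $(i,j)\in S$, there is a map $c\colon\mathrm{alph}(u)\to\mathbb{B}$ whose extension to a morphism satisfies $c(u)=v$. For $I=(i,j)\in\mathcal{S}(n)$, the reflection $\rho_I\colon\{i,\dots,j\}\to\{i,\dots,j\}$ is $\rho_I(k)=i+j-k$. -}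

module Defs where

open import Data.Nat using (ℕ; _+_)
open import Data.Fin using (Fin; toℕ; _≤_)
open import Data.Product using (_×_; Σ; _,_; proj₁; proj₂)
open import Data.List using (List)
open import Data.List.Membership.Propositional using (_∈_)
open import Relation.Binary.PropositionalEquality using (_≡_)
open import Relation.Binary.Construct.Closure.ReflexiveTransitive using (Star)

-- Positions are 0-based: Fin n = {0,…,n-1} stands for {1,…,n}.
-- A word of length n over A is a map Fin n → A.
-- An interval (i , j) ∈ 𝒮(n) is a pair with i ≤ j.

_∈ᵢ_ : {n : ℕ} → Fin n → Fin n × Fin n → Set
k ∈ᵢ (i , j) = (i ≤ k) × (k ≤ j)

Reflects : {n : ℕ} → Fin n × Fin n → Fin n → Fin n → Set
Reflects (i , j) k l = (k ∈ᵢ (i , j)) × (toℕ k + toℕ l ≡ toℕ i + toℕ j)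

IsPal : {A : Set} {n : ℕ} → (Fin n → A) → Fin n × Fin n → Set
IsPal u I = ∀ k l → Reflects I k l → u k ≡ u l

Step : {n : ℕ} → List (Fin n × Fin n) → Fin n → Fin n → Set
Step S k l = Σ _ λ I → (I ∈ S) × Reflects I k l

Reachable : {n : ℕ} → List (Fin n × Fin n) → Fin n → Fin n → Set
Reachable S = Star (Step S)

PalGenerates : {A : Set} {n : ℕ} → List (Fin n × Fin n) → (Fin n → A) → Set₁
PalGenerates {A} {n} S u =
  (∀ I → I ∈ S → IsPal u I) ×
  (∀ (B : Set) → B → (v : Fin n → B) → (∀ I → I ∈ S → IsPal v I) →
     Σ (A → B) λ c → ∀ k → c (u k) ≡ v k)

-- Every word palindromic on S is constant along reflection paths, so when the
-- letter classes of u are exactly the reflection orbits, such a word v is a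
-- letter-to-letter image of u. Conversely, the indicator word of the orbit of
-- i is palindromic on S; if S generates u, this word is an image of u, so
-- u i ≡ u j puts j in the orbit of i. Reachability between finitely many
-- positions is decidable, which makes the indicator word definable.
module Submission where

open import Defs
open import Data.Nat using (ℕ; suc)
open import Data.Fin using (Fin; _≤_; _<_)
open import Data.Product using (_×_; proj₁; proj₂)
open import Data.List using (List)
open import Data.List.Relation.Unary.All using (All)
open import Function.Bundles using (_↔_; _⇔_)
open import Relation.Binary.PropositionalEquality using (_≡_)

open import Level using (Level)
open import Data.Bool using (Bool; true)
open import Data.Empty using (⊥-elim)
open import Data.Fin using (toℕ)
open import Data.Fin.Properties using (_≤?_; <-cmp; any?; inj⇒≟)
  renaming (_≟_ to _≟ᶠ_)
open import Data.List using ([]; _∷_; filter; cartesianProduct; allFin)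
open import Data.List.Membership.Propositional using (_∈_; find; lose)
open import Data.List.Membership.Propositional.Properties
  using (∈-filter⁺; ∈-filter⁻; ∈-cartesianProduct⁺; ∈-allFin)
open import Data.List.Relation.Unary.Any using (here; there)
import Data.List.Relation.Unary.Any as Any
import Data.Nat as ℕ
open import Data.Nat.Properties using (+-comm; +-cancelˡ-≤; +-monoˡ-≤; +-monoʳ-≤; module ≤-Reasoning)
open import Data.Product using (Σ; ∃; _,_; uncurry)
open import Data.Sum using (_⊎_; inj₁; inj₂)
open import Function.Bundles using (mk⇔; Equivalence)
open import Function.Properties.Inverse using (↔⇒↣)
open import Relation.Binary.Core using (Rel)
open import Relation.Binary.Definitions using (Decidable; DecidableEquality; Reflexive; Symmetric; tri<; tri≈; tri>)
open import Relation.Binary.PropositionalEquality using (refl; sym; trans; cong; module ≡-Reasoning)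
open import Relation.Binary.Construct.Closure.ReflexiveTransitive
  using (Star; ε; _◅_; _◅◅_; fold; reverse)
  renaming (map to Star-map)
open import Relation.Nullary using (Dec; yes; no; does)
open import Relation.Nullary.Decidable using (map′; _×-dec_; _⊎-dec_; does-⇔; dec-true)

private variable
  a r : Level

does≡true⇒ : {A : Set a} (a? : Dec A) → does a? ≡ true → A
does≡true⇒ (yes x) _ = x
does≡true⇒ (no _) ()

∀<⇒∀ : ∀ {n} {P : Rel (Fin n) r} → Reflexive P → Symmetric P →
  (∀ i j → i < j → P i j) → ∀ i j → P i j
∀<⇒∀ refl′ sym′ P< i j with <-cmp i j
... | tri< i<j _ _  = P< i j i<j
... | tri≈ _ refl _ = refl′
... | tri> _ _ j<i  = sym′ (P< j i j<i)

module _ {A B : Set} (_≟_ : DecidableEquality A) {n : ℕ} (u : Fin n → A) (v : Fin n → B) where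

  factorise : B → (∀ {k l} → u k ≡ u l → v k ≡ v l) → Σ (A → B) λ c → ∀ k → c (u k) ≡ v k
  factorise b u≡⇒v≡ = c , λ k → pick-u k (any? λ k′ → u k′ ≟ u k)
    where
    pick : (x : A) → Dec (∃ λ k → u k ≡ x) → B
    pick _ (yes (k , _)) = v k
    pick _ (no _)        = b

    c : A → B
    c x = pick x (any? λ k → u k ≟ x)

    pick-u : ∀ k d → pick (u k) d ≡ v k
    pick-u k (yes (k′ , uk′≡uk)) = u≡⇒v≡ uk′≡uk
    pick-u k (no ∄k)             = ⊥-elim (∄k (k , refl))

module _ {I : Set a} where

  Edge : List (I × I) → Rel I a
  Edge E x y = (x , y) ∈ E

  Star-Edge-∷⁻ : ∀ {k l E x y} → Star (Edge ((k , l) ∷ E)) x y →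
    Star (Edge E) x y ⊎ (Star (Edge E) x k × Star (Edge E) l y)
  Star-Edge-∷⁻ ε = inj₁ ε
  Star-Edge-∷⁻ (here refl ◅ rest) with Star-Edge-∷⁻ rest
  ... | inj₁ l⇝y       = inj₂ (ε , l⇝y)
  ... | inj₂ (_ , l⇝y) = inj₂ (ε , l⇝y)
  Star-Edge-∷⁻ (there e ◅ rest) with Star-Edge-∷⁻ rest
  ... | inj₁ z⇝y         = inj₁ (e ◅ z⇝y)
  ... | inj₂ (z⇝k , l⇝y) = inj₂ (e ◅ z⇝k , l⇝y)

  Star-Edge-∷⁺ : ∀ {k l E x y} →
    Star (Edge E) x y ⊎ (Star (Edge E) x k × Star (Edge E) l y) →
    Star (Edge ((k , l) ∷ E)) x y
  Star-Edge-∷⁺ (inj₁ x⇝y)         = Star-map there x⇝y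
  Star-Edge-∷⁺ (inj₂ (x⇝k , l⇝y)) = Star-map there x⇝k ◅◅ here refl ◅ Star-map there l⇝y

  Star-Edge? : DecidableEquality I → ∀ E → Decidable (Star (Edge E))
  Star-Edge? _≟_ [] x y with x ≟ y
  ... | yes refl = yes ε
  ... | no x≢y   = no λ { ε → x≢y refl ; (() ◅ _) }
  Star-Edge? _≟_ ((k , l) ∷ E) x y = map′ Star-Edge-∷⁺ Star-Edge-∷⁻
    (Star-Edge? _≟_ E x y ⊎-dec (Star-Edge? _≟_ E x k ×-dec Star-Edge? _≟_ E l y))

module _ {n : ℕ} {R : Rel (Fin n) r} (R? : Decidable R) where

  private
    pairs edges : List (Fin n × Fin n)
    pairs = cartesianProduct (allFin n) (allFin n)
    edges = filter (uncurry R?) pairs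

  Star? : Decidable (Star R)
  Star? x y = map′
    (Star-map λ e → proj₂ (∈-filter⁻ (uncurry R?) {xs = pairs} e))
    (Star-map λ {k} {l} → ∈-filter⁺ (uncurry R?) (∈-cartesianProduct⁺ (∈-allFin k) (∈-allFin l)))
    (Star-Edge? _≟ᶠ_ edges x y)

module _ {n : ℕ} where

  Reflects? : ∀ I → Decidable (Reflects {n} I)
  Reflects? (i , j) k l = ((i ≤? k) ×-dec (k ≤? j)) ×-dec (toℕ k ℕ.+ toℕ l ℕ.≟ toℕ i ℕ.+ toℕ j)

  Reflects-sym : ∀ {I} → Symmetric (Reflects {n} I)
  Reflects-sym {i , j} {k} {l} ((i≤k , k≤j) , k+l≡i+j) = (i≤l , l≤j) , trans (+-comm (toℕ l) (toℕ k)) k+l≡i+j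
    where
    open ≤-Reasoning

    i≤l : i ≤ l
    i≤l = +-cancelˡ-≤ (toℕ k) (toℕ i) (toℕ l) (begin
      toℕ k ℕ.+ toℕ i ≡⟨ +-comm (toℕ k) (toℕ i) ⟩
      toℕ i ℕ.+ toℕ k ≤⟨ +-monoʳ-≤ (toℕ i) k≤j ⟩
      toℕ i ℕ.+ toℕ j ≡⟨ sym k+l≡i+j ⟩
      toℕ k ℕ.+ toℕ l ∎)

    l≤j : l ≤ j
    l≤j = +-cancelˡ-≤ (toℕ k) (toℕ l) (toℕ j) (begin
      toℕ k ℕ.+ toℕ l ≡⟨ k+l≡i+j ⟩
      toℕ i ℕ.+ toℕ j ≤⟨ +-monoˡ-≤ (toℕ j) i≤k ⟩
      toℕ k ℕ.+ toℕ j ∎)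

  Step? : ∀ S → Decidable (Step {n} S)
  Step? S k l = map′ find (λ (_ , I∈S , k↦l) → lose I∈S k↦l) (Any.any? (λ I → Reflects? I k l) S)

  Step-sym : ∀ {S} → Symmetric (Step {n} S)
  Step-sym (I , I∈S , k↦l) = I , I∈S , Reflects-sym k↦l

  Reachable? : ∀ S → Decidable (Reachable {n} S)
  Reachable? S = Star? (Step? S)

  Reachable-sym : ∀ {S} → Symmetric (Reachable {n} S)
  Reachable-sym = reverse Step-sym

module _ {n : ℕ} (S : List (Fin n × Fin n)) where

  AllPal : {B : Set} → (Fin n → B) → Set
  AllPal v = ∀ I → I ∈ S → IsPal v I

  AllPal⇒Reachable⇒≡ : {B : Set} {v : Fin n → B} → AllPal v →
    ∀ {k l} → Reachable S k l → v k ≡ v l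
  AllPal⇒Reachable⇒≡ {v = v} pal = fold (λ k l → v k ≡ v l)
    (λ (I , I∈S , k↦l) → trans (pal I I∈S _ _ k↦l)) refl

  reachableFrom : Fin n → Fin n → Bool
  reachableFrom i k = does (Reachable? S i k)

  reachableFrom-pal : ∀ i → AllPal (reachableFrom i)
  reachableFrom-pal i I I∈S k l k↦l = does-⇔
    (mk⇔ (_◅◅ (I , I∈S , k↦l) ◅ ε) (_◅◅ (I , I∈S , Reflects-sym k↦l) ◅ ε))
    (Reachable? S i k) (Reachable? S i l)

  reachableFrom-true⇒Reachable : ∀ {i k} → reachableFrom i k ≡ true → Reachable S i k
  reachableFrom-true⇒Reachable {i} {k} = does≡true⇒ (Reachable? S i k)

  KernelIsReachable : {A : Set} → (Fin n → A) → Set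
  KernelIsReachable u = ∀ k l → u k ≡ u l ⇔ Reachable S k l

  PalGenerates⇒KernelIsReachable : {A : Set} (u : Fin n → A) →
    PalGenerates S u → KernelIsReachable u
  PalGenerates⇒KernelIsReachable u (pal , generate) k l = mk⇔ ≡⇒Reachable (AllPal⇒Reachable⇒≡ pal)
    where
    ≡⇒Reachable : u k ≡ u l → Reachable S k l
    ≡⇒Reachable uk≡ul with generate Bool true (reachableFrom k) (reachableFrom-pal k)
    ... | c , c∘u≗v = reachableFrom-true⇒Reachable (begin
      reachableFrom k l ≡⟨ sym (c∘u≗v l) ⟩
      c (u l)           ≡⟨ cong c (sym uk≡ul) ⟩
      c (u k)           ≡⟨ c∘u≗v k ⟩
      reachableFrom k k ≡⟨ dec-true (Reachable? S k k) ε ⟩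
      true              ∎)
      where open ≡-Reasoning

  KernelIsReachable⇒PalGenerates : {A : Set} → DecidableEquality A → (u : Fin n → A) →
    KernelIsReachable u → PalGenerates S u
  KernelIsReachable⇒PalGenerates _≟_ u ker = pal , generate
    where
    pal : AllPal u
    pal I I∈S k l k↦l = Equivalence.from (ker k l) ((I , I∈S , k↦l) ◅ ε)

    generate : ∀ (B : Set) → B → (v : Fin n → B) → AllPal v →
      Σ _ λ c → ∀ k → c (u k) ≡ v k
    generate B b v vpal = factorise _≟_ u v b
      λ {k} {l} uk≡ul → AllPal⇒Reachable⇒≡ vpal (Equivalence.to (ker k l) uk≡ul)

lemma2 : {A : Set} (m : ℕ) → A ↔ Fin (suc m) →
    (n : ℕ) (u : Fin n → A) (S : List (Fin n × Fin n)) →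
    All (λ I → proj₁ I ≤ proj₂ I) S →
    PalGenerates S u ⇔
      (∀ (i j : Fin n) → i < j → (u i ≡ u j ⇔ Reachable S i j))
lemma2 _ A↔Fin _ u S _ = mk⇔
  (λ gen i j _ → PalGenerates⇒KernelIsReachable S u gen i j)
  (λ ker< → KernelIsReachable⇒PalGenerates S (inj⇒≟ (↔⇒↣ A↔Fin)) u
    (∀<⇒∀ (mk⇔ (λ _ → ε) (λ _ → refl)) kernel-sym ker<))
  where
  kernel-sym : Symmetric (λ i j → u i ≡ u j ⇔ Reachable S i j)
  kernel-sym i~j = mk⇔ (λ uj≡ui → Reachable-sym (Equivalence.to i~j (sym uj≡ui)))
                       (λ j⇝i → sym (Equivalence.from i~j (Reachable-sym j⇝i)))
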